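{- Let $\alpha^*$ be a marked permutation with $\oplus$-factorization $\alpha^*=\epsilon_1\oplus\cdots\oplus\epsilon_u\oplus\beta^*\oplus\lambda_v\oplus\cdots\oplus\lambda_1$, where $\epsilon_1,\dots,\epsilon_u,\lambda_1,\dots,\lambda_v$ are $\oplus$-indecomposable permutations, $\beta^*$ is a $\oplus$-indecomposable marked permutation, and $u+v>0$. Let $\alpha^*=\sigma^*\star\gamma^*$ be any factorization with $\sigma^*$ an irreducible marked permutation. Then: if $u>0$ and $v>0$, either $\sigma^*=\bar1\oplus\lambda_1$ or $\sigma^*=\epsilon_1\oplus\bar1$; if $u=0$, then $\sigma^*=\bar1\oplus\lambda_1$; if $v=0$, then $\sigma^*=\epsilon_1\oplus\bar1$.
   Context: A permutation on a finite set $I$ is a pair of total orders on $I$; a marked permutation on $I$ is a pair of total orders $(\le_P,\le_V)$ on $I\sqcup\{*\}$; marked permutations are considered up to isomorphism (bijections preserving both orders, fixing $*$). $\bar1$ is the marked permutation on $\emptyset$. $\pi\oplus\tau$ (for $\pi$ on $I$, $\tau$ on disjoint $J$) extends both orders by placing all of $I$ before all of $J$ in both orders; a marked argument is treated as a permutation on its set plus $*$, the result marked at $*$. A permutation is $\oplus$-indecomposable if nonempty and not $\tau_1\oplus\tau_2$ with both nonempty; a marked permutation is $\oplus$-indecomposable if it is not of the form $\tau\oplus\pi^*$ or $\pi^*\oplus\tau$ with $\tau$ a nonempty permutation. Inflation $\tau^*\star\pi^*$ replaces $*$ in $\tau^*$ by the block $J\sqcup\{*\}$ ordered as in $\pi^*$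 in both orders. $\pi^*\ne\bar1$ is irreducible if every factorization $\pi^*=\tau_1^*\star\tau_2^*$ has a factor equal to $\bar1$. -}

module Defs where

open import Data.Nat using (ℕ; zero; suc; _+_; _∸_; _<_; _<ᵇ_)
open import Data.Bool using (if_then_else_)
open import Data.List using (List; []; _∷_; _++_; map; length; upTo; take; drop; foldr; reverse)
open import Data.List.Relation.Binary.Permutation.Propositional using (_↭_)
open import Data.Product using (_×_; ∃; ∃-syntax; _,_)
open import Data.Sum using (_⊎_)
open import Relation.Binary.PropositionalEquality using (_≡_)
open import Relation.Nullary using (¬_)

-- A permutation on a finite set I (pair of total orders ≤P, ≤V), up to
-- isomorphism, is represented by the list of value-ranks (0-based) of the
-- elements of I listed in ≤P-order.  Two permutations are isomorphic iff
-- their representing lists are equal.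
Perm : Set
Perm = List ℕ

IsPerm : List ℕ → Set
IsPerm xs = xs ↭ upTo (length xs)

-- A marked permutation on I ⊔ {*}: the value-rank list of all elements of
-- I ⊔ {*} in ≤P-order, together with the ≤P-position of *.
record MPerm : Set where
  constructor mperm
  field
    vals : List ℕ
    mark : ℕ
open MPerm public

IsMPerm : MPerm → Set
IsMPerm π = IsPerm (vals π) × (mark π < length (vals π))

one* : MPerm
one* = mperm (0 ∷ []) 0

infixr 6 _⊕_ _⊕ʳ_
infixl 6 _⊕ˡ_

_⊕_ : Perm → Perm → Perm
τ ⊕ π = τ ++ map (λ v → length τ + v) π

_⊕ʳ_ : Perm → MPerm → MPerm
τ ⊕ʳ π = mperm (τ ++ map (λ v → length τ + v) (vals π)) (length τ + mark π)

_⊕ˡ_ : MPerm → Perm → MPerm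
π ⊕ˡ τ = mperm (vals π ++ map (λ v → length (vals π) + v) τ) (mark π)

⨁ : List Perm → Perm
⨁ = foldr _⊕_ []

-- entry at a position (default 0, only used within range)
at : List ℕ → ℕ → ℕ
at []       _       = 0
at (x ∷ xs) zero    = x
at (x ∷ xs) (suc i) = at xs i

-- inflation τ* ⋆ π*: replace * of τ* by the block (J ⊔ {*}) ordered as in π*
_⋆_ : MPerm → MPerm → MPerm
τ ⋆ π = mperm (map sh (take m t) ++ map (λ w → tm + w) (vals π) ++ map sh (drop (suc m) t))
              (m + mark π)
  where
    t  = vals τ
    m  = mark τ
    tm = at t m
    j  = length (vals π) ∸ 1
    sh : ℕ → ℕ
    sh v = if v <ᵇ tm then v else v + j

Indec : Perm → Set
Indec π = (¬ π ≡ []) ×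
  (¬ (∃[ τ₁ ] ∃[ τ₂ ] (IsPerm τ₁ × IsPerm τ₂ × ¬ τ₁ ≡ [] × ¬ τ₂ ≡ [] × π ≡ τ₁ ⊕ τ₂)))

IndecM : MPerm → Set
IndecM α = ¬ (∃[ τ ] ∃[ π ] (IsPerm τ × IsMPerm π × ¬ τ ≡ [] ×
                             (α ≡ τ ⊕ʳ π ⊎ α ≡ π ⊕ˡ τ)))

Irreducible : MPerm → Set
Irreducible σ = (¬ σ ≡ one*) ×
  (∀ τ₁ τ₂ → IsMPerm τ₁ → IsMPerm τ₂ → σ ≡ τ₁ ⋆ τ₂ → τ₁ ≡ one* ⊎ τ₂ ≡ one*)

-- Since u + v > 0, the values of α* = σ* ⋆ γ* split as X ++ Y with X a nonempty block of the smallest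
-- values and Y nonempty (a proper cut).  Such a cut lies before, after or inside the block that γ*
-- occupies in σ* ⋆ γ*, and in each case it comes from a proper cut of σ* (inside the block, the inflated
-- entry of σ* is itself the cut point).  If the values of an irreducible σ* are X ⊕ Y with X, Y nonempty,
-- then σ* = (X ⊕ 1̄) ⋆ π when the mark lies in the Y part and σ* = (1̄ ⊕ Y) ⋆ π otherwise, so π = 1̄:
-- σ* = X ⊕ 1̄ or σ* = 1̄ ⊕ Y.  In the first case α* = X ⊕ γ*; comparing with α* = ε₁ ⊕ ⋯ gives X = ε₁,
-- since a proper refinement would split ε₁ or contradict the irreducibility of X ⊕ 1̄, while for u = 0
-- the summand X would split off β*.  The second case is symmetric.
module Submission where

open import Defs
open import Data.Bool using (true; false; if_then_else_)
open import Data.Empty using (⊥; ⊥-elim)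
open import Data.List using (List; []; _∷_; _++_; map; length; upTo; filter; reverse; take; drop)
open import Data.List.Properties
  using (∷-injective; ++-assoc; ++-identityʳ; map-id; map-id-local; map-cong; map-∘; map-++; map-injective;
         length-++; length-++-≤ˡ; length-map; map-upTo; length-upTo; filter-++; filter-all; filter-none;
         filter-complete; unfold-reverse)
open import Data.List.Relation.Unary.All as All using (All; []; _∷_)
import Data.List.Relation.Unary.All.Properties as AllP
open import Data.List.Relation.Binary.Permutation.Propositional using (_↭_; ↭-refl; ↭-sym)
import Data.List.Relation.Binary.Permutation.Propositional.Properties as PermP
open import Data.List.Membership.Propositional.Properties using (∈-upTo⁺)
open import Data.Nat using (ℕ; zero; suc; _+_; _∸_; _<_; _≤_; _<ᵇ_; _<?_; _≤?_; z≤n; s≤s; z<s)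
open import Data.Nat.Properties
  using (+-assoc; +-comm; +-identityʳ; ≤-refl; ≤-trans; ≤-<-trans; <-≤-trans; <-trans; ≤-total; <⇒≤;
         m≤m+n; +-monoʳ-<; +-monoʳ-≤; +-monoˡ-≤; ≤-reflexive; +-cancelˡ-≡; +-cancelˡ-<; +-cancelʳ-<; +-cancelʳ-≤;
         m+[n∸m]≡n; m+n∸m≡n; ∸-monoˡ-<; <⇒≱; ≤⇒≯; ≰⇒>; ≮⇒≥; <ᵇ⇒<; <⇒<ᵇ; ≤-pred)
open import Data.Product using (_×_; _,_; proj₁; proj₂; ∃₂; ∃-syntax)
open import Data.Sum using (_⊎_; inj₁; inj₂)
import Data.Sum as Sum
open import Data.Unit using (tt)
open import Function using (_∘_)
open import Relation.Binary.PropositionalEquality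
  using (_≡_; _≢_; refl; sym; trans; cong; cong₂; subst; subst₂; module ≡-Reasoning)
open import Relation.Nullary using (yes; no)

++-prefix : ∀ {a} {A : Set a} (P Q X Y : List A) → length P ≤ length X → P ++ Q ≡ X ++ Y →
            ∃[ R ] (X ≡ P ++ R × Q ≡ R ++ Y)
++-prefix []      Q X       Y _        eq = X , refl , eq
++-prefix (p ∷ P) Q (x ∷ X) Y (s≤s le) eq with ∷-injective eq
... | refl , eq′ with ++-prefix P Q X Y le eq′
...   | R , X≡ , Q≡ = R , cong (p ∷_) X≡ , Q≡

map-≡-++ : ∀ {a b} {A : Set a} {B : Set b} (f : A → B) V (P Q : List B) → map f V ≡ P ++ Q →
           ∃₂ λ V₁ V₂ → V ≡ V₁ ++ V₂ × map f V₁ ≡ P × map f V₂ ≡ Q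
map-≡-++ f V       []      Q eq = [] , V , refl , refl , eq
map-≡-++ f (v ∷ V) (p ∷ P) Q eq with ∷-injective eq
... | fv≡p , eq′ with map-≡-++ f V P Q eq′
...   | V₁ , V₂ , V≡ , P≡ , Q≡ = v ∷ V₁ , V₂ , cong (v ∷_) V≡ , cong₂ _∷_ fv≡p P≡ , Q≡

map-≢[] : ∀ {a b} {A : Set a} {B : Set b} {f : A → B} {V : List A} → V ≢ [] → map f V ≢ []
map-≢[] {V = []}    V≢[] _ = V≢[] refl
map-≢[] {V = _ ∷ _} _    ()

++-∷-≢[] : ∀ {a} {A : Set a} (P : List A) {x Q} → P ++ x ∷ Q ≢ []
++-∷-≢[] []      ()
++-∷-≢[] (_ ∷ _) ()

map-+-above : ∀ k (V : List ℕ) → All (k ≤_) (map (k +_) V)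
map-+-above k V = AllP.map⁺ (All.universal (m≤m+n k) V)

map-∸-+ : ∀ k (V : List ℕ) → map (_∸ k) (map (k +_) V) ≡ V
map-∸-+ k V = trans (sym (map-∘ V)) (trans (map-cong (m+n∸m≡n k) V) (map-id V))

map-+-∸ : ∀ k {V : List ℕ} → All (k ≤_) V → map (k +_) (map (_∸ k) V) ≡ V
map-+-∸ k k≤V = trans (sym (map-∘ _)) (map-id-local (All.map m+[n∸m]≡n k≤V))

-- Direct sums

⊕-length : ∀ (X Y : Perm) → length (X ⊕ Y) ≡ length X + length Y
⊕-length X Y = trans (length-++ X) (cong (length X +_) (length-map _ Y))

⊕-identityˡ : ∀ (Y : Perm) → [] ⊕ Y ≡ Y
⊕-identityˡ = map-id

⊕-identityʳ : ∀ (X : Perm) → X ⊕ [] ≡ X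
⊕-identityʳ = ++-identityʳ

map-+-⊕ : ∀ (X Y : Perm) Z → map (length (X ⊕ Y) +_) Z ≡ map (length X +_) (map (length Y +_) Z)
map-+-⊕ X Y Z =
  trans (map-cong (λ v → trans (cong (_+ v) (⊕-length X Y)) (+-assoc (length X) (length Y) v)) Z) (map-∘ Z)

⊕-assoc : ∀ (X Y Z : Perm) → (X ⊕ Y) ⊕ Z ≡ X ⊕ (Y ⊕ Z)
⊕-assoc X Y Z = begin
  (X ++ map (length X +_) Y) ++ map (length (X ⊕ Y) +_) Z
    ≡⟨ ++-assoc X _ _ ⟩
  X ++ (map (length X +_) Y ++ map (length (X ⊕ Y) +_) Z)
    ≡⟨ cong (λ Z′ → X ++ (map (length X +_) Y ++ Z′)) (map-+-⊕ X Y Z) ⟩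
  X ++ (map (length X +_) Y ++ map (length X +_) (map (length Y +_) Z))
    ≡⟨ cong (X ++_) (sym (map-++ _ Y _)) ⟩
  X ⊕ (Y ⊕ Z) ∎
  where open ≡-Reasoning

⊕ʳ-assoc : ∀ (X Y : Perm) π → (X ⊕ Y) ⊕ʳ π ≡ X ⊕ʳ (Y ⊕ʳ π)
⊕ʳ-assoc X Y π =
  cong₂ mperm (⊕-assoc X Y (vals π))
              (trans (cong (_+ mark π) (⊕-length X Y)) (+-assoc (length X) (length Y) (mark π)))

⊕ˡ-assoc : ∀ π (Y Z : Perm) → π ⊕ˡ (Y ⊕ Z) ≡ (π ⊕ˡ Y) ⊕ˡ Z
⊕ˡ-assoc π Y Z = cong₂ mperm (sym (⊕-assoc (vals π) Y Z)) refl

⊕ʳ-⊕ˡ-assoc : ∀ (X : Perm) π (Z : Perm) → X ⊕ʳ (π ⊕ˡ Z) ≡ (X ⊕ʳ π) ⊕ˡ Z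
⊕ʳ-⊕ˡ-assoc X π Z = cong₂ mperm (sym (⊕-assoc X (vals π) Z)) refl

⊕ʳ-identityˡ : ∀ π → [] ⊕ʳ π ≡ π
⊕ʳ-identityˡ π = cong₂ mperm (⊕-identityˡ (vals π)) refl

⊕ˡ-identityʳ : ∀ π → π ⊕ˡ [] ≡ π
⊕ˡ-identityʳ π = cong₂ mperm (⊕-identityʳ (vals π)) refl

⊕ʳ-one*-conical : ∀ {X} → X ⊕ʳ one* ≡ one* → X ≡ []
⊕ʳ-one*-conical {[]}    _  = refl
⊕ʳ-one*-conical {_ ∷ _} ()

one*-⊕ˡ-conical : ∀ {Y} → one* ⊕ˡ Y ≡ one* → Y ≡ []
one*-⊕ˡ-conical {[]}    _  = refl
one*-⊕ˡ-conical {_ ∷ _} ()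

⨁-snoc : ∀ xs l → ⨁ (xs ++ l ∷ []) ≡ ⨁ xs ⊕ l
⨁-snoc []       l = trans (⊕-identityʳ l) (sym (⊕-identityˡ l))
⨁-snoc (x ∷ xs) l = trans (cong (x ⊕_) (⨁-snoc xs l)) (sym (⊕-assoc x (⨁ xs) l))

-- Permutations of upTo n

upTo-+ : ∀ k r → upTo (k + r) ≡ upTo k ++ map (k +_) (upTo r)
upTo-+ zero    r = sym (map-id (upTo r))
upTo-+ (suc k) r = begin
  upTo (suc k + r)                                      ≡⟨ upTo-suc (k + r) ⟩
  0 ∷ map suc (upTo (k + r))                            ≡⟨ cong (λ U → 0 ∷ map suc U) (upTo-+ k r) ⟩
  0 ∷ map suc (upTo k ++ map (k +_) (upTo r))           ≡⟨ cong (0 ∷_) (map-++ suc (upTo k) _) ⟩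
  0 ∷ map suc (upTo k) ++ map suc (map (k +_) (upTo r))
    ≡⟨ cong (λ U → 0 ∷ map suc (upTo k) ++ U) (sym (map-∘ (upTo r))) ⟩
  0 ∷ map suc (upTo k) ++ map (suc k +_) (upTo r)       ≡⟨ cong (_++ map (suc k +_) (upTo r)) (sym (upTo-suc k)) ⟩
  upTo (suc k) ++ map (suc k +_) (upTo r)               ∎
  where
  open ≡-Reasoning
  upTo-suc : ∀ n → upTo (suc n) ≡ 0 ∷ map suc (upTo n)
  upTo-suc n = cong (0 ∷_) (sym (map-upTo suc n))

filter-<-upTo : ∀ k r → filter (_<? k) (upTo (k + r)) ≡ upTo k
filter-<-upTo k r = begin
  filter (_<? k) (upTo (k + r))                                   ≡⟨ cong (filter _) (upTo-+ k r) ⟩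
  filter (_<? k) (upTo k ++ map (k +_) (upTo r))                  ≡⟨ filter-++ _ (upTo k) _ ⟩
  filter (_<? k) (upTo k) ++ filter (_<? k) (map (k +_) (upTo r))
    ≡⟨ cong₂ _++_ (filter-all _ (AllP.all-upTo k)) (filter-none _ (All.map ≤⇒≯ (map-+-above k (upTo r)))) ⟩
  upTo k ++ []                                                    ≡⟨ ++-identityʳ (upTo k) ⟩
  upTo k                                                          ∎
  where open ≡-Reasoning

filter-≥-upTo : ∀ k r → filter (k ≤?_) (upTo (k + r)) ≡ map (k +_) (upTo r)
filter-≥-upTo k r = trans (cong (filter _) (upTo-+ k r))
  (trans (filter-++ _ (upTo k) _)
         (cong₂ _++_ (filter-none _ (All.map <⇒≱ (AllP.all-upTo k))) (filter-all _ (map-+-above k (upTo r)))))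

↭-upTo-length : ∀ {xs n} → xs ↭ upTo n → length xs ≡ n
↭-upTo-length {n = n} p = trans (PermP.↭-length p) (length-upTo n)

↭-upTo-below : ∀ {xs n} → xs ↭ upTo n → All (_< n) xs
↭-upTo-below {n = n} p = PermP.All-resp-↭ (↭-sym p) (AllP.all-upTo n)

↭-upTo-lower-block : ∀ {X Y k r} → X ++ Y ↭ upTo (k + r) → All (_< k) X → All (k ≤_) Y → X ↭ upTo k
↭-upTo-lower-block {X} {Y} {k} {r} p X<k k≤Y =
  subst₂ _↭_ lower (filter-<-upTo k r) (PermP.filter-↭ (_<? k) p)
  where
  lower : filter (_<? k) (X ++ Y) ≡ X
  lower = trans (filter-++ _ X Y)
                (trans (cong₂ _++_ (filter-all _ X<k) (filter-none _ (All.map ≤⇒≯ k≤Y))) (++-identityʳ X))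

isPerm-upper-above : ∀ {X Y} → IsPerm (X ++ Y) → All (_< length X) X → All (length X ≤_) Y
isPerm-upper-above {X} {Y} p X<k = subst (All (k ≤_)) kept (AllP.all-filter (k ≤?_) Y)
  where
  k = length X
  upper : filter (k ≤?_) (X ++ Y) ≡ filter (k ≤?_) Y
  upper = trans (filter-++ _ X Y) (cong (_++ filter (k ≤?_) Y) (filter-none _ (All.map <⇒≱ X<k)))
  upper-perm : filter (k ≤?_) Y ↭ map (k +_) (upTo (length Y))
  upper-perm = subst₂ _↭_ upper (filter-≥-upTo k (length Y))
    (PermP.filter-↭ (k ≤?_) (subst (λ n → X ++ Y ↭ upTo n) (length-++ X) p))
  kept : filter (k ≤?_) Y ≡ Y
  kept = filter-complete _ (trans (PermP.↭-length upper-perm)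
                                  (trans (length-map _ (upTo (length Y))) (length-upTo (length Y))))

⊕-isPerm : ∀ {X Y} → IsPerm X → IsPerm Y → IsPerm (X ⊕ Y)
⊕-isPerm {X} {Y} pX pY = subst (λ n → X ⊕ Y ↭ upTo n) (sym (⊕-length X Y))
  (subst (X ⊕ Y ↭_) (sym (upTo-+ (length X) (length Y))) (PermP.++⁺ pX (PermP.map⁺ (length X +_) pY)))

-- The values of map (k +_) Y are at least k, so the filter below k recovers X and the one above k recovers Y.
⊕-isPerm⁻ : ∀ X Y → IsPerm (X ⊕ Y) → IsPerm X × IsPerm Y
⊕-isPerm⁻ X Y p = X-perm , Y-perm
  where
  k = length X
  p′ : X ⊕ Y ↭ upTo (k + length Y)
  p′ = subst (λ n → X ⊕ Y ↭ upTo n) (⊕-length X Y) p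
  lower : filter (_<? k) (X ⊕ Y) ≡ filter (_<? k) X
  lower = trans (filter-++ _ X _)
                (trans (cong (filter (_<? k) X ++_) (filter-none _ (All.map ≤⇒≯ (map-+-above k Y)))) (++-identityʳ _))
  lower-perm : filter (_<? k) X ↭ upTo k
  lower-perm = subst₂ _↭_ lower (filter-<-upTo k (length Y)) (PermP.filter-↭ (_<? k) p′)
  X-perm : IsPerm X
  X-perm = subst (_↭ upTo k) (filter-complete _ (↭-upTo-length lower-perm)) lower-perm
  upper : filter (k ≤?_) (X ⊕ Y) ≡ map (k +_) Y
  upper = trans (filter-++ _ X _)
                (cong₂ _++_ (filter-none _ (All.map <⇒≱ (↭-upTo-below X-perm))) (filter-all _ (map-+-above k Y)))
  Y-perm : IsPerm Y
  Y-perm = subst₂ _↭_ (map-∸-+ k Y) (map-∸-+ k (upTo (length Y)))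
    (PermP.map⁺ (_∸ k) (subst₂ _↭_ upper (filter-≥-upTo k (length Y)) (PermP.filter-↭ (k ≤?_) p′)))

⨁-isPerm : ∀ {xs} → All IsPerm xs → IsPerm (⨁ xs)
⨁-isPerm []         = ↭-refl
⨁-isPerm (px ∷ pxs) = ⊕-isPerm px (⨁-isPerm pxs)

indec-⊕ : ∀ X Y → IsPerm (X ⊕ Y) → Indec (X ⊕ Y) → X ≡ [] ⊎ Y ≡ []
indec-⊕ []      Y       _ _              = inj₁ refl
indec-⊕ (x ∷ X) []      _ _              = inj₂ refl
indec-⊕ (x ∷ X) (y ∷ Y) p (_ , no-split) =
  ⊥-elim (no-split (x ∷ X , y ∷ Y , proj₁ parts , proj₂ parts , (λ ()) , (λ ()) , refl))
  where parts = ⊕-isPerm⁻ (x ∷ X) (y ∷ Y) p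

isMPerm-vals≢[] : ∀ {π} → IsMPerm π → vals π ≢ []
isMPerm-vals≢[] (_ , m<) π≡[] = <⇒≱ m< (subst (λ V → length V ≤ _) (sym π≡[]) z≤n)

one*-isMPerm : IsMPerm one*
one*-isMPerm = ↭-refl , z<s

⊕ʳ-isMPerm : ∀ {X π} → IsPerm X → IsMPerm π → IsMPerm (X ⊕ʳ π)
⊕ʳ-isMPerm {X} {π} pX (pπ , m<) =
  ⊕-isPerm pX pπ , subst (length X + mark π <_) (sym (⊕-length X (vals π))) (+-monoʳ-< (length X) m<)

⊕ˡ-isMPerm : ∀ {π Y} → IsMPerm π → IsPerm Y → IsMPerm (π ⊕ˡ Y)
⊕ˡ-isMPerm {π} (pπ , m<) pY = ⊕-isPerm pπ pY , <-≤-trans m< (length-++-≤ˡ (vals π))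

⊕ʳ-split : ∀ {α X Y} → IsMPerm α → vals α ≡ X ⊕ Y → length X ≤ mark α → ∃[ π ] (IsMPerm π × α ≡ X ⊕ʳ π)
⊕ʳ-split {mperm V m} {X} {Y} (pV , m<) refl X≤m =
  mperm Y (m ∸ length X) ,
  (proj₂ (⊕-isPerm⁻ X Y pV) ,
   subst (m ∸ length X <_) (m+n∸m≡n (length X) (length Y)) (∸-monoˡ-< (subst (m <_) (⊕-length X Y) m<) X≤m)) ,
  cong₂ mperm refl (sym (m+[n∸m]≡n X≤m))

⊕ˡ-split : ∀ {α X Y} → IsMPerm α → vals α ≡ X ⊕ Y → mark α < length X → ∃[ π ] (IsMPerm π × α ≡ π ⊕ˡ Y)
⊕ˡ-split {mperm V m} {X} {Y} (pV , _) refl m<X = mperm X m , (proj₁ (⊕-isPerm⁻ X Y pV) , m<X) , refl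

-- Inflation

shift : ℕ → ℕ → ℕ → ℕ
shift t j v = if v <ᵇ t then v else v + j

shift-cases : ∀ t j v → (v < t × shift t j v ≡ v) ⊎ (t ≤ v × shift t j v ≡ v + j)
shift-cases t j v with v <? t
... | yes v<t = inj₁ (v<t , below v<t)
  where
  below : v < t → shift t j v ≡ v
  below v<t with v <ᵇ t | <⇒<ᵇ v<t
  ... | true | _ = refl
... | no v≮t = inj₂ (≮⇒≥ v≮t , above (≮⇒≥ v≮t))
  where
  above : t ≤ v → shift t j v ≡ v + j
  above t≤v with v <ᵇ t | <ᵇ⇒< v t
  ... | true  | v<t = ⊥-elim (<⇒≱ (v<t tt) t≤v)
  ... | false | _   = refl

split-at-index : ∀ (V : List ℕ) m → m < length V → ∃[ A ] ∃[ t ] ∃[ B ] (V ≡ A ++ t ∷ B × m ≡ length A)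
split-at-index (v ∷ V) zero    _        = [] , v , V , refl , refl
split-at-index (v ∷ V) (suc m) (s≤s m<) with split-at-index V m m<
... | A , t , B , V≡ , m≡ = v ∷ A , t , B , cong (v ∷_) V≡ , cong suc m≡

⋆-vals : ∀ A t B π → let j = length (vals π) ∸ 1 in
         vals (mperm (A ++ t ∷ B) (length A) ⋆ π) ≡ map (shift t j) A ++ map (t +_) (vals π) ++ map (shift t j) B
⋆-vals A t B π =
  cong₂ _++_ (trans (map-cong sh≗shift _) (cong (map _) (take-length A)))
    (cong₂ _++_ (map-cong (λ w → cong (_+ w) (at-length A)) (vals π))
                (trans (map-cong sh≗shift _) (cong (map _) (drop-length A))))
  where
  j = length (vals π) ∸ 1
  take-length : ∀ A → take (length A) (A ++ t ∷ B) ≡ A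
  take-length []      = refl
  take-length (a ∷ A) = cong (a ∷_) (take-length A)
  drop-length : ∀ A → drop (suc (length A)) (A ++ t ∷ B) ≡ B
  drop-length []      = refl
  drop-length (_ ∷ A) = drop-length A
  at-length : ∀ A → at (A ++ t ∷ B) (length A) ≡ t
  at-length []      = refl
  at-length (_ ∷ A) = at-length A
  sh≗shift : ∀ v → (if v <ᵇ at (A ++ t ∷ B) (length A) then v else v + j) ≡ shift t j v
  sh≗shift v = cong (λ s → shift s j v) (at-length A)

⊕ʳ-one*-⋆ : ∀ X π → All (_< length X) X → (X ⊕ʳ one*) ⋆ π ≡ X ⊕ʳ π
⊕ʳ-one*-⋆ X π X<k = begin
  (X ⊕ʳ one*) ⋆ π
    ≡⟨ cong (_⋆ π) (cong₂ (λ t m → mperm (X ++ t ∷ []) m) (+-identityʳ k) (+-identityʳ k)) ⟩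
  mperm (X ++ k ∷ []) k ⋆ π
    ≡⟨ cong₂ mperm (trans (⋆-vals X k [] π) (cong₂ _++_ (map-id-local (All.map fixed X<k)) (++-identityʳ _))) refl ⟩
  X ⊕ʳ π ∎
  where
  open ≡-Reasoning
  k = length X
  fixed : ∀ {v} → v < k → shift k (length (vals π) ∸ 1) v ≡ v
  fixed {v} v<k with shift-cases k (length (vals π) ∸ 1) v
  ... | inj₁ (_ , e)   = e
  ... | inj₂ (k≤v , _) = ⊥-elim (<⇒≱ v<k k≤v)

one*-⊕ˡ-⋆ : ∀ Y π → vals π ≢ [] → (one* ⊕ˡ Y) ⋆ π ≡ π ⊕ˡ Y
one*-⊕ˡ-⋆ Y π π≢[] =
  cong₂ mperm (cong₂ _++_ (map-id (vals π)) (trans (sym (map-∘ Y)) (map-cong shifted Y))) refl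
  where
  shifted : ∀ v → suc v + (length (vals π) ∸ 1) ≡ length (vals π) + v
  shifted v = trans (cong suc (+-comm v _)) (cong (_+ v) (m+[n∸m]≡n (nonempty (vals π) π≢[])))
    where
    nonempty : ∀ (V : List ℕ) → V ≢ [] → 1 ≤ length V
    nonempty []      V≢[] = ⊥-elim (V≢[] refl)
    nonempty (_ ∷ _) _    = s≤s z≤n

irreducible-⊕ʳ : ∀ {X π} → IsPerm X → X ≢ [] → IsMPerm π → Irreducible (X ⊕ʳ π) → π ≡ one*
irreducible-⊕ʳ {X} {π} pX X≢[] isπ (_ , factors)
  with factors (X ⊕ʳ one*) π (⊕ʳ-isMPerm pX one*-isMPerm) isπ (sym (⊕ʳ-one*-⋆ X π (↭-upTo-below pX)))
... | inj₁ e = ⊥-elim (X≢[] (⊕ʳ-one*-conical e))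
... | inj₂ e = e

irreducible-⊕ˡ : ∀ {π Y} → IsPerm Y → Y ≢ [] → IsMPerm π → Irreducible (π ⊕ˡ Y) → π ≡ one*
irreducible-⊕ˡ {π} {Y} pY Y≢[] isπ (_ , factors)
  with factors (one* ⊕ˡ Y) π (⊕ˡ-isMPerm one*-isMPerm pY) isπ (sym (one*-⊕ˡ-⋆ Y π (isMPerm-vals≢[] isπ)))
... | inj₁ e = ⊥-elim (Y≢[] (one*-⊕ˡ-conical e))
... | inj₂ e = e

-- The side of the mark decides between the factorizations (X ⊕ʳ one*) ⋆ π and (one* ⊕ˡ Y) ⋆ π.
irreducible-⊕-shape : ∀ {σ X Y} → IsMPerm σ → Irreducible σ → vals σ ≡ X ⊕ Y → X ≢ [] → Y ≢ [] →
                      σ ≡ X ⊕ʳ one* ⊎ σ ≡ one* ⊕ˡ Y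
irreducible-⊕-shape {σ} {X} {Y} isσ irr σ≡ X≢[] Y≢[]
  with length X ≤? mark σ | ⊕-isPerm⁻ X Y (subst IsPerm σ≡ (proj₁ isσ))
... | yes X≤m | pX , _ with ⊕ʳ-split {X = X} {Y} isσ σ≡ X≤m
...   | π , isπ , refl = inj₁ (cong (X ⊕ʳ_) (irreducible-⊕ʳ pX X≢[] isπ irr))
irreducible-⊕-shape {σ} {X} {Y} isσ irr σ≡ X≢[] Y≢[] | no X≰m | _ , pY with ⊕ˡ-split {X = X} {Y} isσ σ≡ (≰⇒> X≰m)
...   | π , isπ , refl = inj₂ (cong (_⊕ˡ Y) (irreducible-⊕ˡ pY Y≢[] isπ irr))

-- Cuts

record ProperCut (s : List ℕ) : Set where
  constructor properCut
  field
    lower upper : List ℕ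
    splits      : s ≡ lower ++ upper
    lower-below : All (_< length lower) lower
    upper-above : All (length lower ≤_) upper
    lower≢[]    : lower ≢ []
    upper≢[]    : upper ≢ []

Decomposable : Perm → Set
Decomposable s = ∃₂ λ X Y → X ≢ [] × Y ≢ [] × s ≡ X ⊕ Y

properCut⇒decomposable : ∀ {s} → ProperCut s → Decomposable s
properCut⇒decomposable (properCut X Y refl _ k≤Y X≢[] Y≢[]) =
  X , map (_∸ length X) Y , X≢[] , map-≢[] Y≢[] , cong (X ++_) (sym (map-+-∸ (length X) k≤Y))

decomposable⇒properCut : ∀ {s} → IsPerm s → Decomposable s → ProperCut s
decomposable⇒properCut p (X , Y , X≢[] , Y≢[] , refl) =
  properCut X (map (length X +_) Y) refl (↭-upTo-below (proj₁ (⊕-isPerm⁻ X Y p))) (map-+-above (length X) Y)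
            X≢[] (map-≢[] Y≢[])

pivot-position : ∀ {A t B} → IsPerm (A ++ t ∷ B) → All (_< t) A → All (t ≤_) B → length A ≡ t
pivot-position {A} {t} {B} p A<t t≤B = ↭-upTo-length (↭-upTo-lower-block p′ A<t (≤-refl ∷ t≤B))
  where
  n = length (A ++ t ∷ B)
  t<n : t < n
  t<n = All.head (AllP.++⁻ʳ A (↭-upTo-below p))
  p′ : A ++ t ∷ B ↭ upTo (t + (n ∸ t))
  p′ = subst (λ m → A ++ t ∷ B ↭ upTo m) (sym (m+[n∸m]≡n (<⇒≤ t<n))) p

pivot-cut : ∀ A {t B} → IsPerm (A ++ t ∷ B) → A ++ B ≢ [] → All (_< t) A → All (t ≤_) B → ProperCut (A ++ t ∷ B)
pivot-cut [] {t} {B} p B≢[] _ t≤B =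
  properCut (t ∷ []) B refl (t<1 ∷ []) (isPerm-upper-above p (t<1 ∷ [])) (λ ()) B≢[]
  where
  t<1 : t < 1
  t<1 = subst (_< 1) (pivot-position {[]} p [] t≤B) z<s
pivot-cut (a ∷ A) {t} {B} p _ A<t t≤B =
  properCut (a ∷ A) (t ∷ B) refl (subst (λ k → All (_< k) (a ∷ A)) (sym A≡t) A<t)
            (subst (λ k → All (k ≤_) (t ∷ B)) (sym A≡t) (≤-refl ∷ t≤B)) (λ ()) (λ ())
  where A≡t = pivot-position p A<t t≤B

module Block {g : List ℕ} {j : ℕ} (g-perm : g ↭ upTo (suc j)) (t : ℕ) where

  sh : ℕ → ℕ
  sh = shift t j

  block : List ℕ
  block = map (t +_) g

  block-length : length block ≡ suc j
  block-length = trans (length-map _ g) (↭-upTo-length g-perm)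

  block-first : ∀ {P : ℕ → Set} → All P block → P t
  block-first {P} all = subst P (+-identityʳ t)
    (All.lookup (AllP.map⁻ all) (PermP.∈-resp-↭ (↭-sym g-perm) (∈-upTo⁺ z<s)))

  block-last : ∀ {P : ℕ → Set} → All P block → P (t + j)
  block-last all = All.lookup (AllP.map⁻ all) (PermP.∈-resp-↭ (↭-sym g-perm) (∈-upTo⁺ ≤-refl))

  block-≤ : All (_≤ t + j) block
  block-≤ = AllP.map⁺ (All.map (λ v<sj → +-monoʳ-≤ t (≤-pred v<sj)) (↭-upTo-below g-perm))

  cut-before-block : ∀ A₁ A₂ B → A₁ ≢ [] → All (_< length (map sh A₁)) (map sh A₁) →
                     All (length (map sh A₁) ≤_) (map sh A₂ ++ block ++ map sh B) → ProperCut ((A₁ ++ A₂) ++ t ∷ B)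
  cut-before-block A₁ A₂ B A₁≢[] below above =
    properCut A₁ (A₂ ++ t ∷ B) (++-assoc A₁ A₂ (t ∷ B)) (All.map reflect-< (AllP.map⁻ below′))
              (AllP.++⁺ (All.map reflect-≥ (AllP.map⁻ a₂)) (q≤t ∷ All.map reflect-≥ (AllP.map⁻ b)))
              A₁≢[] (++-∷-≢[] A₂)
    where
    q = length A₁
    below′ = subst (λ k → All (_< k) (map sh A₁)) (length-map sh A₁) below
    above′ = subst (λ k → All (k ≤_) (map sh A₂ ++ block ++ map sh B)) (length-map sh A₁) above
    a₂ = AllP.++⁻ˡ (map sh A₂) above′
    rest = AllP.++⁻ʳ (map sh A₂) above′
    b = AllP.++⁻ʳ block rest
    q≤t : q ≤ t
    q≤t = block-first (AllP.++⁻ˡ block rest)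
    reflect-< : ∀ {v} → sh v < q → v < q
    reflect-< {v} with shift-cases t j v
    ... | inj₁ (_ , e) = subst (_< q) e
    ... | inj₂ (_ , e) = λ lt → ≤-<-trans (m≤m+n v j) (subst (_< q) e lt)
    reflect-≥ : ∀ {v} → q ≤ sh v → q ≤ v
    reflect-≥ {v} with shift-cases t j v
    ... | inj₁ (_ , e)   = subst (q ≤_) e
    ... | inj₂ (t≤v , _) = λ _ → ≤-trans q≤t t≤v

  cut-after-block : ∀ A B₁ B₂ → B₂ ≢ [] →
                    All (_< length (map sh A ++ block ++ map sh B₁)) (map sh A ++ block ++ map sh B₁) →
                    All (length (map sh A ++ block ++ map sh B₁) ≤_) (map sh B₂) → ProperCut (A ++ t ∷ (B₁ ++ B₂))
  cut-after-block A B₁ B₂ B₂≢[] below above =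
    properCut (A ++ t ∷ B₁) B₂ (sym (++-assoc A (t ∷ B₁) B₂))
              (AllP.++⁺ (All.map reflect-< (AllP.map⁻ a)) (t<k ∷ All.map reflect-< (AllP.map⁻ b₁)))
              (All.map reflect-≥ (AllP.map⁻ above′)) (++-∷-≢[] A) B₂≢[]
    where
    k = length (A ++ t ∷ B₁)
    q≡ : length (map sh A ++ block ++ map sh B₁) ≡ k + j
    q≡ = begin
      length (map sh A ++ block ++ map sh B₁)         ≡⟨ length-++ (map sh A) ⟩
      length (map sh A) + length (block ++ map sh B₁) ≡⟨ cong₂ _+_ (length-map sh A) (length-++ block) ⟩
      length A + (length block + length (map sh B₁))
        ≡⟨ cong₂ (λ b c → length A + (b + c)) block-length (length-map sh B₁) ⟩
      length A + suc (j + length B₁)                  ≡⟨ cong (λ c → length A + suc c) (+-comm j (length B₁)) ⟩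
      length A + (suc (length B₁) + j)                ≡⟨ sym (+-assoc (length A) (suc (length B₁)) j) ⟩
      length A + suc (length B₁) + j                  ≡⟨ cong (_+ j) (sym (length-++ A)) ⟩
      k + j                                           ∎
      where open ≡-Reasoning
    below′ = subst (λ q → All (_< q) (map sh A ++ block ++ map sh B₁)) q≡ below
    above′ = subst (λ q → All (q ≤_) (map sh B₂)) q≡ above
    a = AllP.++⁻ˡ (map sh A) below′
    rest = AllP.++⁻ʳ (map sh A) below′
    b₁ = AllP.++⁻ʳ block rest
    t<k : t < k
    t<k = +-cancelʳ-< j t k (block-last (AllP.++⁻ˡ block rest))
    reflect-< : ∀ {v} → sh v < k + j → v < k
    reflect-< {v} with shift-cases t j v
    ... | inj₁ (v<t , _) = λ _ → <-trans v<t t<k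
    ... | inj₂ (_ , e)   = λ lt → +-cancelʳ-< j v k (subst (_< k + j) e lt)
    reflect-≥ : ∀ {v} → k + j ≤ sh v → k ≤ v
    reflect-≥ {v} with shift-cases t j v
    ... | inj₁ (v<t , e) = λ ge → ⊥-elim (<⇒≱ (<-trans v<t t<k) (≤-trans (m≤m+n k j) (subst (k + j ≤_) e ge)))
    ... | inj₂ (_ , e)   = λ ge → +-cancelʳ-≤ j k v (subst (k + j ≤_) e ge)

  cut-inside-block : ∀ A B → IsPerm (A ++ t ∷ B) → A ++ B ≢ [] → ∀ {q} → t < q → q ≤ t + j →
                     All (_< q) (map sh A) → All (q ≤_) (map sh B) → ProperCut (A ++ t ∷ B)
  cut-inside-block A B p nontrivial {q} t<q q≤t+j below above =
    pivot-cut A p nontrivial (All.map reflect-< (AllP.map⁻ below)) (All.map reflect-≥ (AllP.map⁻ above))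
    where
    reflect-< : ∀ {v} → sh v < q → v < t
    reflect-< {v} with shift-cases t j v
    ... | inj₁ (v<t , _) = λ _ → v<t
    ... | inj₂ (t≤v , e) = λ lt → ⊥-elim (<⇒≱ lt (≤-trans q≤t+j (subst (t + j ≤_) (sym e) (+-monoˡ-≤ j t≤v))))
    reflect-≥ : ∀ {v} → q ≤ sh v → t ≤ v
    reflect-≥ {v} with shift-cases t j v
    ... | inj₁ (v<t , e) = λ ge → ⊥-elim (<⇒≱ (<-trans v<t t<q) (subst (q ≤_) e ge))
    ... | inj₂ (t≤v , _) = λ _ → t≤v

  block-cut : ∀ {A B} → IsPerm (A ++ t ∷ B) → A ++ B ≢ [] →
              ProperCut (map sh A ++ block ++ map sh B) → ProperCut (A ++ t ∷ B)
  block-cut {A} {B} p nontrivial (properCut X Y split below above X≢[] Y≢[]) with length X ≤? length (map sh A)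
  ... | yes X≤A with ++-prefix X Y (map sh A) (block ++ map sh B) X≤A (sym split)
  ...   | R , A≡ , refl with map-≡-++ sh A X R A≡
  ...     | A₁ , A₂ , refl , refl , refl = cut-before-block A₁ A₂ B (X≢[] ∘ cong (map sh)) below above
  block-cut {A} {B} p nontrivial (properCut X Y split below above X≢[] Y≢[]) | no X≰A
    with ++-prefix (map sh A) (block ++ map sh B) X Y (<⇒≤ (≰⇒> X≰A)) split
  ... | R , refl , rest≡ with length block ≤? length R
  ...   | yes blk≤R with ++-prefix block (map sh B) R Y blk≤R rest≡
  ...     | R′ , refl , B≡ with map-≡-++ sh B R′ Y B≡
  ...       | B₁ , B₂ , refl , refl , refl = cut-after-block A B₁ B₂ (Y≢[] ∘ cong (map sh)) below above
  block-cut {A} {B} p nontrivial (properCut X Y split below above X≢[] Y≢[]) | no X≰A | [] , refl , _ | no _ =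
    ⊥-elim (X≰A (≤-reflexive (cong length (++-identityʳ (map sh A)))))
  block-cut {A} {B} p nontrivial (properCut X Y split below above X≢[] Y≢[]) | no X≰A | x ∷ R , refl , rest≡ | no blk≰R
    with ++-prefix (x ∷ R) Y block (map sh B) (<⇒≤ (≰⇒> blk≰R)) (sym rest≡)
  ... | [] , block≡ , refl = ⊥-elim (blk≰R (≤-reflexive (cong length (trans block≡ (++-identityʳ (x ∷ R))))))
  ... | y ∷ R′ , block≡ , refl =
    cut-inside-block A B p nontrivial t<q q≤t+j (AllP.++⁻ˡ (map sh A) below) (AllP.++⁻ʳ (y ∷ R′) above)
    where
    t<q : t < length (map sh A ++ x ∷ R)
    t<q = ≤-<-trans (All.head (subst (All (t ≤_)) block≡ (map-+-above t g))) (All.head (AllP.++⁻ʳ (map sh A) below))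
    q≤t+j : length (map sh A ++ x ∷ R) ≤ t + j
    q≤t+j = ≤-trans (All.head above) (All.head (AllP.++⁻ʳ (x ∷ R) (subst (All (_≤ t + j)) block≡ block-≤)))

≢one*⇒++≢[] : ∀ A {t} B → IsPerm (A ++ t ∷ B) → mperm (A ++ t ∷ B) (length A) ≢ one* → A ++ B ≢ []
≢one*⇒++≢[] []      []      p σ≢one* _ = σ≢one* (cong (λ V → mperm V 0) (PermP.↭-singleton-inv p))
≢one*⇒++≢[] []      (_ ∷ _) _ _      ()
≢one*⇒++≢[] (_ ∷ _) _       _ _      ()

⋆-reflects-cut : ∀ {σ γ} → IsMPerm σ → IsMPerm γ → σ ≢ one* → ProperCut (vals (σ ⋆ γ)) → ProperCut (vals σ)
⋆-reflects-cut {mperm V m} {γ} (pV , m<) (pγ , mγ<) σ≢one* c with split-at-index V m m<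
... | A , t , B , refl , refl =
  Block.block-cut g-perm t pV (≢one*⇒++≢[] A B pV σ≢one*) (subst ProperCut (⋆-vals A t B γ) c)
  where
  g-perm : vals γ ↭ upTo (suc (length (vals γ) ∸ 1))
  g-perm = subst (λ n → vals γ ↭ upTo n) (sym (m+[n∸m]≡n (≤-<-trans z≤n mγ<))) pγ

irreducible-factor-shape : ∀ {σ γ} → IsMPerm σ → IsMPerm γ → Irreducible σ →
                           IsPerm (vals (σ ⋆ γ)) → Decomposable (vals (σ ⋆ γ)) →
                           (∃[ X ] (IsPerm X × X ≢ [] × σ ≡ X ⊕ʳ one*)) ⊎ (∃[ Y ] (IsPerm Y × Y ≢ [] × σ ≡ one* ⊕ˡ Y))
irreducible-factor-shape {σ} isσ isγ irr p d
  with properCut⇒decomposable (⋆-reflects-cut isσ isγ (proj₁ irr) (decomposable⇒properCut p d))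
... | X , Y , X≢[] , Y≢[] , σ≡ =
  Sum.map (λ e → X , proj₁ parts , X≢[] , e) (λ e → Y , proj₂ parts , Y≢[] , e)
          (irreducible-⊕-shape isσ irr σ≡ X≢[] Y≢[])
  where parts = ⊕-isPerm⁻ X Y (subst IsPerm σ≡ (proj₁ isσ))

⊕-≡-⊕ : ∀ (A B C D : Perm) → length A ≤ length C → A ⊕ B ≡ C ⊕ D → ∃[ P ] (C ≡ A ⊕ P × B ≡ P ⊕ D)
⊕-≡-⊕ A B C D A≤C eq with ++-prefix A (map (length A +_) B) C (map (length C +_) D) A≤C eq
... | R , refl , shifted with map-≡-++ (length A +_) B R (map (length (A ++ R) +_) D) shifted
...   | P , B₂ , refl , refl , B₂≡ =
  P , refl , cong (P ++_) (map-injective (λ {x} {y} → +-cancelˡ-≡ (length A) x y) (trans B₂≡ (map-+-⊕ A P D)))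

irreducible-left-summand : ∀ {X e G R} → IsPerm X → X ≢ [] → Irreducible (X ⊕ʳ one*) → IsPerm e → Indec e →
                           X ⊕ G ≡ e ⊕ R → X ≡ e
irreducible-left-summand {X} {e} {G} {R} pX X≢[] irr pe ie eq with ≤-total (length X) (length e)
... | inj₁ X≤e with ⊕-≡-⊕ X G e R X≤e eq
...   | P , refl , _ with indec-⊕ X P pe ie
...     | inj₁ refl = ⊥-elim (X≢[] refl)
...     | inj₂ refl = sym (⊕-identityʳ X)
irreducible-left-summand {X} {e} {G} {R} pX X≢[] irr pe ie eq | inj₂ e≤X with ⊕-≡-⊕ e R X G e≤X (sym eq)
...   | P , refl , _
  with ⊕ʳ-one*-conical (irreducible-⊕ʳ pe (proj₁ ie) (⊕ʳ-isMPerm (proj₂ (⊕-isPerm⁻ e P pX)) one*-isMPerm)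
                                       (subst Irreducible (⊕ʳ-assoc e P one*) irr))
...     | refl = ⊕-identityʳ e

irreducible-right-summand : ∀ {Y l G R} → IsPerm Y → Y ≢ [] → Irreducible (one* ⊕ˡ Y) → IsPerm l → Indec l →
                            G ⊕ Y ≡ R ⊕ l → Y ≡ l
irreducible-right-summand {Y} {l} {G} {R} pY Y≢[] irr pl il eq with ≤-total (length G) (length R)
... | inj₁ G≤R with ⊕-≡-⊕ G Y R l G≤R eq
...   | P , _ , refl
  with one*-⊕ˡ-conical (irreducible-⊕ˡ pl (proj₁ il) (⊕ˡ-isMPerm one*-isMPerm (proj₁ (⊕-isPerm⁻ P l pY)))
                                       (subst Irreducible (⊕ˡ-assoc one* P l) irr))
...     | refl = ⊕-identityˡ l
irreducible-right-summand {Y} {l} {G} {R} pY Y≢[] irr pl il eq | inj₂ R≤G with ⊕-≡-⊕ R l G Y R≤G (sym eq)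
...   | P , _ , refl with indec-⊕ P Y pl il
...     | inj₁ refl = sym (⊕-identityˡ Y)
...     | inj₂ refl = ⊥-elim (Y≢[] refl)

no-left-summand : ∀ {X γ β W} → IsMPerm β → IndecM β → IsPerm X → X ≢ [] → X ⊕ʳ γ ≢ β ⊕ˡ W
no-left-summand {X} {γ} {β} {W} isβ indβ pX X≢[] eq = compare (≤-total (length X) (length (vals β)))
  where
  X≤m : length X ≤ mark β
  X≤m = subst (length X ≤_) (cong mark eq) (m≤m+n (length X) (mark γ))
  compare : length X ≤ length (vals β) ⊎ length (vals β) ≤ length X → ⊥
  compare (inj₁ X≤β) with ⊕-≡-⊕ X (vals γ) (vals β) W X≤β (cong vals eq)
  ... | P , β≡ , _ with ⊕ʳ-split isβ β≡ X≤m
  ...   | π , isπ , β≡′ = indβ (X , π , pX , isπ , X≢[] , inj₁ β≡′)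
  compare (inj₂ β≤X) = <⇒≱ (proj₂ isβ) (≤-trans β≤X X≤m)

no-right-summand : ∀ {γ Y E β} → IsMPerm γ → IsMPerm β → IndecM β → IsPerm Y → Y ≢ [] → γ ⊕ˡ Y ≢ E ⊕ʳ β
no-right-summand {γ} {Y} {E} {β} isγ isβ indβ pY Y≢[] eq = compare (≤-total (length E) (length (vals γ)))
  where
  m≡ : mark γ ≡ length E + mark β
  m≡ = cong mark eq
  compare : length E ≤ length (vals γ) ⊎ length (vals γ) ≤ length E → ⊥
  compare (inj₁ E≤γ) with ⊕-≡-⊕ E (vals β) (vals γ) Y E≤γ (sym (cong vals eq))
  ... | P , γ≡ , β≡
    with ⊕ˡ-split isβ β≡
           (+-cancelˡ-< (length E) _ _ (subst₂ _<_ m≡ (trans (cong length γ≡) (⊕-length E P)) (proj₂ isγ)))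
  ...   | π , isπ , β≡′ = indβ (Y , π , pY , isπ , Y≢[] , inj₂ β≡′)
  compare (inj₂ γ≤E) = <⇒≱ (proj₂ isγ) (≤-trans γ≤E (subst (length E ≤_) (sym m≡) (m≤m+n _ _)))

-- α* es β ls = ε₁ ⊕ ⋯ ⊕ εᵤ ⊕ β* ⊕ λᵥ ⊕ ⋯ ⊕ λ₁

α* : List Perm → MPerm → List Perm → MPerm
α* es β ls = ⨁ es ⊕ʳ (β ⊕ˡ ⨁ (reverse ls))

α*-isMPerm : ∀ {es β ls} → All IsPerm es → IsMPerm β → All IsPerm ls → IsMPerm (α* es β ls)
α*-isMPerm {ls = ls} pes isβ pls =
  ⊕ʳ-isMPerm (⨁-isPerm pes) (⊕ˡ-isMPerm isβ (⨁-isPerm (PermP.All-resp-↭ (↭-sym (PermP.↭-reverse ls)) pls)))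

α*-∷ˡ : ∀ e es β ls → α* (e ∷ es) β ls ≡ e ⊕ʳ α* es β ls
α*-∷ˡ e es β ls = ⊕ʳ-assoc e (⨁ es) _

α*-∷ʳ : ∀ es β l ls → α* es β (l ∷ ls) ≡ α* es β ls ⊕ˡ l
α*-∷ʳ es β l ls = begin
  ⨁ es ⊕ʳ (β ⊕ˡ ⨁ (reverse (l ∷ ls)))
    ≡⟨ cong (λ W → ⨁ es ⊕ʳ (β ⊕ˡ W)) (trans (cong ⨁ (unfold-reverse l ls)) (⨁-snoc (reverse ls) l)) ⟩
  ⨁ es ⊕ʳ (β ⊕ˡ (⨁ (reverse ls) ⊕ l))  ≡⟨ cong (⨁ es ⊕ʳ_) (⊕ˡ-assoc β _ l) ⟩
  ⨁ es ⊕ʳ ((β ⊕ˡ ⨁ (reverse ls)) ⊕ˡ l) ≡⟨ ⊕ʳ-⊕ˡ-assoc (⨁ es) _ l ⟩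
  α* es β ls ⊕ˡ l                       ∎
  where open ≡-Reasoning

α*-decomposable : ∀ es β ls → All IsPerm es → All Indec es → All IsPerm ls → All Indec ls → IsMPerm β →
                  0 < length es + length ls → Decomposable (vals (α* es β ls))
α*-decomposable (e ∷ es) β ls pes ies pls _ isβ _ =
  e , vals (α* es β ls) , proj₁ (All.head ies) , isMPerm-vals≢[] (α*-isMPerm (All.tail pes) isβ pls) ,
  cong vals (α*-∷ˡ e es β ls)
α*-decomposable [] β (l ∷ ls) _ _ pls ils isβ _ =
  vals (α* [] β ls) , l , isMPerm-vals≢[] (α*-isMPerm [] isβ (All.tail pls)) , proj₁ (All.head ils) ,
  cong vals (α*-∷ʳ [] β l ls)

Conclusion : List Perm → List Perm → MPerm → Set
Conclusion es ls σ =
  (∀ e es′ l ls′ → es ≡ e ∷ es′ → ls ≡ l ∷ ls′ → σ ≡ one* ⊕ˡ l ⊎ σ ≡ e ⊕ʳ one*)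
  × (es ≡ [] → ∀ l ls′ → ls ≡ l ∷ ls′ → σ ≡ one* ⊕ˡ l)
  × (ls ≡ [] → ∀ e es′ → es ≡ e ∷ es′ → σ ≡ e ⊕ʳ one*)

α*-left-conclusion : ∀ {X γ β ls} es → IsMPerm β → IndecM β → All IsPerm es → All Indec es →
                     IsPerm X → X ≢ [] → Irreducible (X ⊕ʳ one*) → α* es β ls ≡ X ⊕ʳ γ →
                     Conclusion es ls (X ⊕ʳ one*)
α*-left-conclusion [] isβ indβ _ _ pX X≢[] _ eq =
  (λ _ _ _ _ ()) , (λ _ → ⊥-elim (no-left-summand isβ indβ pX X≢[] (trans (sym eq) (⊕ʳ-identityˡ _)))) , (λ _ _ _ ())
α*-left-conclusion {X} {β = β} {ls} (e ∷ es) _ _ pes ies pX X≢[] irr eq =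
  (λ { _ _ _ _ refl _ → inj₂ X⊕1≡e⊕1 }) , (λ ()) , (λ { _ _ _ refl → X⊕1≡e⊕1 })
  where
  X⊕1≡e⊕1 : X ⊕ʳ one* ≡ e ⊕ʳ one*
  X⊕1≡e⊕1 = cong (_⊕ʳ one*) (irreducible-left-summand pX X≢[] irr (All.head pes) (All.head ies)
                                (cong vals (trans (sym eq) (α*-∷ˡ e es β ls))))

α*-right-conclusion : ∀ {Y γ β es} ls → IsMPerm β → IndecM β → IsMPerm γ → All IsPerm ls → All Indec ls →
                      IsPerm Y → Y ≢ [] → Irreducible (one* ⊕ˡ Y) → α* es β ls ≡ γ ⊕ˡ Y →
                      Conclusion es ls (one* ⊕ˡ Y)
α*-right-conclusion {β = β} {es} [] isβ indβ isγ _ _ pY Y≢[] _ eq =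
  (λ _ _ _ _ _ ()) , (λ _ _ _ ()) ,
  (λ _ → ⊥-elim (no-right-summand isγ isβ indβ pY Y≢[] (trans (sym eq) (cong (⨁ es ⊕ʳ_) (⊕ˡ-identityʳ β)))))
α*-right-conclusion {Y} {β = β} {es} (l ∷ ls) _ _ _ pls ils pY Y≢[] irr eq =
  (λ { _ _ _ _ _ refl → inj₁ 1⊕Y≡1⊕l }) , (λ { _ _ _ refl → 1⊕Y≡1⊕l }) , (λ ())
  where
  1⊕Y≡1⊕l : one* ⊕ˡ Y ≡ one* ⊕ˡ l
  1⊕Y≡1⊕l = cong (one* ⊕ˡ_) (irreducible-right-summand pY Y≢[] irr (All.head pls) (All.head ils)
                                (cong vals (trans (sym eq) (α*-∷ʳ es β l ls))))

mainTheorem18 : (es ls : List Perm) (β σ γ : MPerm) →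
    All IsPerm es → All Indec es →
    All IsPerm ls → All Indec ls →
    IsMPerm β → IndecM β →
    0 < length es + length ls →
    IsMPerm σ → IsMPerm γ →
    ⨁ es ⊕ʳ (β ⊕ˡ ⨁ (reverse ls)) ≡ σ ⋆ γ →
    Irreducible σ →
    (∀ e es′ l ls′ → es ≡ e ∷ es′ → ls ≡ l ∷ ls′ →
       σ ≡ one* ⊕ˡ l ⊎ σ ≡ e ⊕ʳ one*)
    × (es ≡ [] → ∀ l ls′ → ls ≡ l ∷ ls′ → σ ≡ one* ⊕ˡ l)
    × (ls ≡ [] → ∀ e es′ → es ≡ e ∷ es′ → σ ≡ e ⊕ʳ one*)
mainTheorem18 es ls β σ γ pes ies pls ils isβ indβ u+v>0 isσ isγ α≡σ⋆γ irr =
  Sum.[ left , right ] (irreducible-factor-shape isσ isγ irr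
    (subst (IsPerm ∘ vals) α≡σ⋆γ (proj₁ (α*-isMPerm pes isβ pls)))
    (subst (Decomposable ∘ vals) α≡σ⋆γ (α*-decomposable es β ls pes ies pls ils isβ u+v>0)))
  where
  left : ∃[ X ] (IsPerm X × X ≢ [] × σ ≡ X ⊕ʳ one*) → Conclusion es ls σ
  left (X , pX , X≢[] , σ≡) = subst (Conclusion es ls) (sym σ≡)
    (α*-left-conclusion es isβ indβ pes ies pX X≢[] (subst Irreducible σ≡ irr)
      (trans α≡σ⋆γ (trans (cong (_⋆ γ) σ≡) (⊕ʳ-one*-⋆ X γ (↭-upTo-below pX)))))
  right : ∃[ Y ] (IsPerm Y × Y ≢ [] × σ ≡ one* ⊕ˡ Y) → Conclusion es ls σ
  right (Y , pY , Y≢[] , σ≡) = subst (Conclusion es ls) (sym σ≡)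
    (α*-right-conclusion ls isβ indβ isγ pls ils pY Y≢[] (subst Irreducible σ≡ irr)
      (trans α≡σ⋆γ (trans (cong (_⋆ γ) σ≡) (one*-⊕ˡ-⋆ Y γ (isMPerm-vals≢[] isγ)))))
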